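{- Let $R$ be a terminating path. Then $R\cup\mathrm{ep}(R)\mathbin{;}\mathrm{sp}(R)^{\top}$ is a cycle.
   Context: $(B,\cup,\mathbin{;},\overline{\,\cdot\,},{}^{\top},{}^{*},\mathsf{I})$ is a Kleene relation algebra; all variables range over $B$. That is, $(B,\cup,\mathbin{;},\overline{\,\cdot\,},{}^{\top},\mathsf{I})$ is a relation algebra: $\cup$ is associative and commutative and $R=\overline{\overline{R}\cup\overline{S}}\cup\overline{\overline{R}\cup S}$; $\mathbin{;}$ is associative, $(R\cup S)\mathbin{;}T=R\mathbin{;}T\cup S\mathbin{;}T$, $R\mathbin{;}\mathsf{I}=R$; $(R^{\top})^{\top}=R$, $(R\cup S)^{\top}=R^{\top}\cup S^{\top}$, $(R\mathbin{;}S)^{\top}=S^{\top}\mathbin{;}R^{\top}$; $R^{\top}\mathbin{;}\overline{R\mathbin{;}S}\cup\overline{S}=\overline{S}$. The order is $R\subseteq S$ iff $R\cup S=S$; $R\cap S=\overline{\overline{R}\cup\overline{S}}$; $\mathsf{L}=R\cup\overline{R}$ is the greatest and $\mathsf{O}=R\cap\overline{R}$ the least element. The star satisfies $\mathsf{I}\cup R\mathbin{;}R^*\subseteq R^*$, $\mathsf{I}\cup R^*\mathbin{;}R\subseteq R^*$, $S\cup R\mathbin{;}Q\subseteq Q\Rightarrow R^*\mathbin{;}S\subseteq Q$, $S\cup Q\mathbin{;}R\subseteq Q\Rightarrow S\mathbin{;}R^*\subseteq Q$. Write $R^{\top*}=(R^{\top})^*$. The algebra satisfies the Tarski rule ($R\neq\mathsf{O}$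 iff $\mathsf{L}\mathbin{;}R\mathbin{;}\mathsf{L}=\mathsf{L}$) and the point axiom (for every $R\neq\mathsf{O}$ there are points $p,q$ with $p\mathbin{;}q^{\top}\subseteq R$), where a point is an element $p$ with $p=p\mathbin{;}\mathsf{L}$, $p\mathbin{;}p^{\top}\subseteq\mathsf{I}$ and $\mathsf{I}\subseteq p^{\top}\mathbin{;}p$. Composition binds tighter than $\cup,\cap$; complement and converse bind tighter than composition. $R$ is univalent if $R^{\top}\mathbin{;}R\subseteq\mathsf{I}$ and injective if $R\mathbin{;}R^{\top}\subseteq\mathsf{I}$. $R$ is connected if $R\mathbin{;}\mathsf{L}\mathbin{;}R\subseteq R^*\cup R^{\top*}$; $R$ is a path if it is injective, univalent and connected. $\mathrm{sp}(R)=R\mathbin{;}\mathsf{L}\cap\overline{R^{\top}\mathbin{;}\mathsf{L}}$ and $\mathrm{ep}(R)=R^{\top}\mathbin{;}\mathsf{L}\cap\overline{R\mathbin{;}\mathsf{L}}$. A path $R$ is terminating if ($\mathrm{sp}(R)\neq\mathsf{O}$ or $R=\mathsf{O}$) and ($\mathrm{ep}(R)\neq\mathsf{O}$ or $R=\mathsf{O}$). A path $R$ is a cycle if $R^*=R^{\top*}$. -}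

module Defs where

open import Level using (Level; suc; _⊔_)
open import Relation.Binary.PropositionalEquality using (_≡_)
open import Relation.Nullary using (¬_)
open import Data.Product using (Σ; ∃; _×_; _,_)
open import Data.Sum using (_⊎_)

record KleeneRelationAlgebra (c : Level) : Set (suc c) where
  infixr 5 _∪_
  infixr 6 _∩_
  infixr 7 _⨾_
  infix 4 _⊆_
  field
    B    : Set c
    _∪_  : B → B → B
    _⨾_  : B → B → B
    ∁    : B → B
    _ᵀ   : B → B
    _*   : B → B
    I    : B

  _⊆_ : B → B → Set c
  R ⊆ S = R ∪ S ≡ S

  _∩_ : B → B → B
  R ∩ S = ∁ (∁ R ∪ ∁ S)

  field
    ∪-assoc   : ∀ R S T → (R ∪ S) ∪ T ≡ R ∪ (S ∪ T)
    ∪-comm    : ∀ R S → R ∪ S ≡ S ∪ R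
    huntington : ∀ R S → R ≡ ∁ (∁ R ∪ ∁ S) ∪ ∁ (∁ R ∪ S)
    ⨾-assoc   : ∀ R S T → (R ⨾ S) ⨾ T ≡ R ⨾ (S ⨾ T)
    ⨾-distribʳ : ∀ R S T → (R ∪ S) ⨾ T ≡ R ⨾ T ∪ S ⨾ T
    ⨾-identityʳ : ∀ R → R ⨾ I ≡ R
    ᵀ-involutive : ∀ R → (R ᵀ) ᵀ ≡ R
    ᵀ-distrib-∪ : ∀ R S → (R ∪ S) ᵀ ≡ R ᵀ ∪ S ᵀ
    ᵀ-distrib-⨾ : ∀ R S → (R ⨾ S) ᵀ ≡ S ᵀ ⨾ R ᵀ
    schröder  : ∀ R S → R ᵀ ⨾ ∁ (R ⨾ S) ∪ ∁ S ≡ ∁ S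
    star-unfoldˡ : ∀ R → I ∪ R ⨾ (R *) ⊆ R *
    star-unfoldʳ : ∀ R → I ∪ (R *) ⨾ R ⊆ R *
    star-inductˡ : ∀ R S Q → S ∪ R ⨾ Q ⊆ Q → (R *) ⨾ S ⊆ Q
    star-inductʳ : ∀ R S Q → S ∪ Q ⨾ R ⊆ Q → S ⨾ (R *) ⊆ Q

  L : B
  L = I ∪ ∁ I

  O : B
  O = I ∩ ∁ I

  IsPoint : B → Set c
  IsPoint p = (p ≡ p ⨾ L) × (p ⨾ p ᵀ ⊆ I) × (I ⊆ p ᵀ ⨾ p)

  field
    -- L = R ∪ R̄ and O = R ∩ R̄ for every R is derivable; we fix R := I.
    tarski : ∀ R → (¬ (R ≡ O) → L ⨾ R ⨾ L ≡ L) × (L ⨾ R ⨾ L ≡ L → ¬ (R ≡ O))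
    point-axiom : ∀ R → ¬ (R ≡ O) →
      Σ B λ p → Σ B λ q → IsPoint p × IsPoint q × (p ⨾ q ᵀ ⊆ R)

  _ᵀ* : B → B
  R ᵀ* = (R ᵀ) *

  Univalent : B → Set c
  Univalent R = R ᵀ ⨾ R ⊆ I

  Injective : B → Set c
  Injective R = R ⨾ R ᵀ ⊆ I

  Connected : B → Set c
  Connected R = R ⨾ L ⨾ R ⊆ (R *) ∪ (R ᵀ*)

  IsPath : B → Set c
  IsPath R = Injective R × Univalent R × Connected R

  sp : B → B
  sp R = R ⨾ L ∩ ∁ (R ᵀ ⨾ L)

  ep : B → B
  ep R = R ᵀ ⨾ L ∩ ∁ (R ⨾ L)

  IsTerminating : B → Set c
  IsTerminating R = IsPath R
    × (¬ (sp R ≡ O) ⊎ R ≡ O)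
    × (¬ (ep R ≡ O) ⊎ R ≡ O)

  IsCycle : B → Set c
  IsCycle R = IsPath R × (R * ≡ R ᵀ*)

-- Write s = sp R and e = ep R; both are vectors. Connectedness shows that they are
-- injective (a path has at most one start and one end point), and with Tarski's rule
-- (s, e ≠ O) that every point of the field of R reaches s backwards and e forwards.
-- Hence for X = R ∪ e ⨾ sᵀ any pair in X ⨾ L ∩ L ⨾ X is linked by Xᵀ*: walk back
-- from its first component to s, take the new edge backwards to e, and walk back from
-- e to its second component. This gives X ⊆ Xᵀ*, so X* = Xᵀ*, and connectedness of X.
-- Injectivity and univalence survive because nothing enters s and nothing leaves e.

module Submission where

open import Defs
open import Level using (Level)
open import Algebra.Bundles using (CommutativeSemigroup)
open import Algebra.Structures using (IsCommutativeSemigroup)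
open import Data.Product using (_,_; proj₁)
open import Data.Sum using (inj₁; inj₂)
open import Function using (_∘_)
open import Relation.Nullary using (¬_)
open import Relation.Binary.PropositionalEquality
open import Relation.Binary.Bundles using (Poset)
import Algebra.Properties.CommutativeSemigroup as CommutativeSemigroupProperties
import Relation.Binary.Reasoning.PartialOrder as PartialOrderReasoning

module KleeneRelationAlgebraProperties {c : Level} (K : KleeneRelationAlgebra c) where

  open KleeneRelationAlgebra K

  -- Boolean algebra

  ∪-isCommutativeSemigroup : IsCommutativeSemigroup _≡_ _∪_
  ∪-isCommutativeSemigroup = record
    { isSemigroup = record
      { isMagma = record { isEquivalence = isEquivalence ; ∙-cong = cong₂ _∪_ }
      ; assoc   = ∪-assoc
      }
    ; comm = ∪-comm
    }

  ∪-commutativeSemigroup : CommutativeSemigroup c c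
  ∪-commutativeSemigroup = record { isCommutativeSemigroup = ∪-isCommutativeSemigroup }

  open CommutativeSemigroupProperties ∪-commutativeSemigroup
    using () renaming (interchange to ∪-interchange)

  ᵀ-identity : I ᵀ ≡ I
  ᵀ-identity = begin
    I ᵀ              ≡⟨ ⨾-identityʳ (I ᵀ) ⟨
    I ᵀ ⨾ I          ≡⟨ cong (I ᵀ ⨾_) (ᵀ-involutive I) ⟨
    I ᵀ ⨾ (I ᵀ) ᵀ    ≡⟨ ᵀ-distrib-⨾ (I ᵀ) I ⟨
    (I ᵀ ⨾ I) ᵀ      ≡⟨ cong _ᵀ (⨾-identityʳ (I ᵀ)) ⟩
    (I ᵀ) ᵀ          ≡⟨ ᵀ-involutive I ⟩
    I                ∎
    where open ≡-Reasoning

  ⨾-identityˡ : ∀ R → I ⨾ R ≡ R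
  ⨾-identityˡ R = begin
    I ⨾ R            ≡⟨ ᵀ-involutive (I ⨾ R) ⟨
    ((I ⨾ R) ᵀ) ᵀ    ≡⟨ cong _ᵀ (ᵀ-distrib-⨾ I R) ⟩
    (R ᵀ ⨾ I ᵀ) ᵀ    ≡⟨ cong (λ X → (R ᵀ ⨾ X) ᵀ) ᵀ-identity ⟩
    (R ᵀ ⨾ I) ᵀ      ≡⟨ cong _ᵀ (⨾-identityʳ (R ᵀ)) ⟩
    (R ᵀ) ᵀ          ≡⟨ ᵀ-involutive R ⟩
    R                ∎
    where open ≡-Reasoning

  -- Huntington's axiom makes every element a join of two complements, and
  -- Schröder's rule at I shows that complements are idempotent.
  ∪-idem-∁ : ∀ R → ∁ R ∪ ∁ R ≡ ∁ R
  ∪-idem-∁ R = begin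
    ∁ R ∪ ∁ R                ≡⟨ cong (_∪ ∁ R) (⨾-identityˡ (∁ R)) ⟨
    I ⨾ ∁ R ∪ ∁ R            ≡⟨ cong₂ (λ X Y → X ⨾ ∁ Y ∪ ∁ R) ᵀ-identity (⨾-identityˡ R) ⟨
    I ᵀ ⨾ ∁ (I ⨾ R) ∪ ∁ R    ≡⟨ schröder I R ⟩
    ∁ R                      ∎
    where open ≡-Reasoning

  ∪-idem : ∀ R → R ∪ R ≡ R
  ∪-idem R = begin
    R ∪ R                    ≡⟨ cong₂ _∪_ (huntington R R) (huntington R R) ⟩
    (A ∪ C) ∪ (A ∪ C)        ≡⟨ ∪-interchange A C A C ⟩
    (A ∪ A) ∪ (C ∪ C)        ≡⟨ cong₂ _∪_ (∪-idem-∁ _) (∪-idem-∁ _) ⟩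
    A ∪ C                    ≡⟨ huntington R R ⟨
    R                        ∎
    where
    A = ∁ (∁ R ∪ ∁ R)
    C = ∁ (∁ R ∪ R)
    open ≡-Reasoning

  ⊆-refl : ∀ {R} → R ⊆ R
  ⊆-refl {R} = ∪-idem R

  ⊆-reflexive : ∀ {R S} → R ≡ S → R ⊆ S
  ⊆-reflexive refl = ⊆-refl

  ⊆-trans : ∀ {R S T} → R ⊆ S → S ⊆ T → R ⊆ T
  ⊆-trans {R} {S} {T} R⊆S S⊆T = begin
    R ∪ T          ≡⟨ cong (R ∪_) S⊆T ⟨
    R ∪ (S ∪ T)    ≡⟨ ∪-assoc R S T ⟨
    (R ∪ S) ∪ T    ≡⟨ cong (_∪ T) R⊆S ⟩
    S ∪ T          ≡⟨ S⊆T ⟩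
    T              ∎
    where open ≡-Reasoning

  ⊆-antisym : ∀ {R S} → R ⊆ S → S ⊆ R → R ≡ S
  ⊆-antisym {R} {S} R⊆S S⊆R = trans (sym S⊆R) (trans (∪-comm S R) R⊆S)

  ⊆-poset : Poset c c c
  ⊆-poset = record
    { _≈_ = _≡_
    ; _≤_ = _⊆_
    ; isPartialOrder = record
      { isPreorder = record
        { isEquivalence = isEquivalence
        ; reflexive     = ⊆-reflexive
        ; trans         = ⊆-trans
        }
      ; antisym = ⊆-antisym
      }
    }

  module ⊆-Reasoning = PartialOrderReasoning ⊆-poset

  ∪-upperˡ : ∀ {R S} → R ⊆ R ∪ S
  ∪-upperˡ {R} {S} = trans (sym (∪-assoc R R S)) (cong (_∪ S) (∪-idem R))

  ∪-upperʳ : ∀ {R S} → S ⊆ R ∪ S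
  ∪-upperʳ {R} {S} = subst (S ⊆_) (∪-comm S R) ∪-upperˡ

  ∪-lub : ∀ {R S T} → R ⊆ T → S ⊆ T → R ∪ S ⊆ T
  ∪-lub {R} {S} {T} R⊆T S⊆T = trans (∪-assoc R S T) (trans (cong (R ∪_) S⊆T) R⊆T)

  ∪-mono : ∀ {R R′ S S′} → R ⊆ R′ → S ⊆ S′ → R ∪ S ⊆ R′ ∪ S′
  ∪-mono R⊆R′ S⊆S′ = ∪-lub (⊆-trans R⊆R′ ∪-upperˡ) (⊆-trans S⊆S′ ∪-upperʳ)

  ∩-lowerˡ : ∀ {R S} → R ∩ S ⊆ R
  ∩-lowerˡ {R} {S} = subst (R ∩ S ⊆_) (sym (huntington R S)) ∪-upperˡ

  ∁-involutive : ∀ R → ∁ (∁ R) ≡ R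
  ∁-involutive R = begin
    ∁ (∁ R)                                     ≡⟨ huntington (∁ (∁ R)) R ⟩
    ∁ (∁ (∁ (∁ R)) ∪ ∁ R) ∪ ∁ (∁ (∁ (∁ R)) ∪ R) ≡⟨ cong (λ X → ∁ (X ∪ ∁ R) ∪ ∁ (X ∪ R)) ∁∁∁≡∁ ⟩
    ∁ (∁ R ∪ ∁ R) ∪ ∁ (∁ R ∪ R)                 ≡⟨ huntington R R ⟨
    R                                           ∎
    where
    open ≡-Reasoning
    ∁[∁∪]⊆ : ∀ X Y → ∁ (∁ X ∪ Y) ⊆ X
    ∁[∁∪]⊆ X Y = subst (∁ (∁ X ∪ Y) ⊆_) (sym (huntington X Y)) ∪-upperʳ
    ∁∁⊆ : ∀ X → ∁ (∁ X) ⊆ X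
    ∁∁⊆ X = subst (λ Y → ∁ Y ⊆ X) (∪-idem-∁ X) ∩-lowerˡ
    ∁⊆∁∁∁ : ∁ R ⊆ ∁ (∁ (∁ R))
    ∁⊆∁∁∁ = subst (λ Y → ∁ Y ⊆ ∁ (∁ (∁ R)))
                  (⊆-trans (∁∁⊆ (∁ (∁ R))) (∁∁⊆ R))
                  (∁[∁∪]⊆ (∁ (∁ (∁ R))) R)
    ∁∁∁≡∁ : ∁ (∁ (∁ R)) ≡ ∁ R
    ∁∁∁≡∁ = ⊆-antisym (∁∁⊆ (∁ R)) ∁⊆∁∁∁

  ∩-comm : ∀ R S → R ∩ S ≡ S ∩ R
  ∩-comm R S = cong ∁ (∪-comm (∁ R) (∁ S))

  ∩-lowerʳ : ∀ {R S} → R ∩ S ⊆ S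
  ∩-lowerʳ {R} {S} = subst (_⊆ S) (∩-comm S R) ∩-lowerˡ

  ∁-∪ : ∀ R S → ∁ (R ∪ S) ≡ ∁ R ∩ ∁ S
  ∁-∪ R S = cong ∁ (cong₂ _∪_ (sym (∁-involutive R)) (sym (∁-involutive S)))

  ∁-antitone : ∀ {R S} → R ⊆ S → ∁ S ⊆ ∁ R
  ∁-antitone {R} {S} R⊆S =
    subst (λ X → ∁ X ⊆ ∁ R) R⊆S (subst (_⊆ ∁ R) (sym (∁-∪ R S)) ∩-lowerˡ)

  ∩-glb : ∀ {R S T} → T ⊆ R → T ⊆ S → T ⊆ R ∩ S
  ∩-glb {R} {S} {T} T⊆R T⊆S =
    subst (_⊆ R ∩ S) (∁-involutive T) (∁-antitone (∪-lub (∁-antitone T⊆R) (∁-antitone T⊆S)))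

  ∩-mono : ∀ {R R′ S S′} → R ⊆ R′ → S ⊆ S′ → R ∩ S ⊆ R′ ∩ S′
  ∩-mono R⊆R′ S⊆S′ = ∩-glb (⊆-trans ∩-lowerˡ R⊆R′) (⊆-trans ∩-lowerʳ S⊆S′)

  ∩-partition : ∀ R S → R ≡ R ∩ S ∪ R ∩ ∁ S
  ∩-partition R S =
    trans (huntington R S) (cong (λ X → R ∩ S ∪ ∁ (∁ R ∪ X)) (sym (∁-involutive S)))

  ⊆∪∁ : ∀ {R S} → R ⊆ S ∪ ∁ S
  ⊆∪∁ {R} {S} = subst (_⊆ S ∪ ∁ S) (sym (∩-partition R S)) (∪-mono ∩-lowerʳ ∩-lowerʳ)

  ⊆-L : ∀ {R} → R ⊆ L
  ⊆-L = ⊆∪∁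

  ∁-L : ∁ L ≡ O
  ∁-L = cong ∁ (trans (∪-comm I (∁ I)) (cong (∁ I ∪_) (sym (∁-involutive I))))

  O-⊆ : ∀ {R} → O ⊆ R
  O-⊆ {R} = subst₂ _⊆_ ∁-L (∁-involutive R) (∁-antitone ⊆-L)

  ⊆O⇒≡O : ∀ {R} → R ⊆ O → R ≡ O
  ⊆O⇒≡O R⊆O = ⊆-antisym R⊆O O-⊆

  ∩-∁-⊆O : ∀ R → R ∩ ∁ R ⊆ O
  ∩-∁-⊆O R = subst₂ (λ X Y → ∁ (∁ R ∪ X) ⊆ Y) (sym (∁-involutive R)) ∁-L
               (∁-antitone (subst (L ⊆_) (∪-comm R (∁ R)) ⊆∪∁))

  disjoint⇒⊆∁ : ∀ {R S} → R ∩ S ⊆ O → R ⊆ ∁ S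
  disjoint⇒⊆∁ {R} {S} R∩S⊆O =
    subst (_⊆ ∁ S) (sym (∩-partition R S)) (∪-lub (⊆-trans R∩S⊆O O-⊆) ∩-lowerʳ)

  ∪-resolveʳ : ∀ {R S T} → R ⊆ S ∪ T → R ⊆ ∁ T → R ⊆ S
  ∪-resolveʳ {R} {S} {T} R⊆S∪T R⊆∁T = begin
    R                          ≤⟨ ∩-glb R⊆S∪T R⊆∁T ⟩
    (S ∪ T) ∩ ∁ T              ≡⟨ ∩-partition _ S ⟩
    ((S ∪ T) ∩ ∁ T) ∩ S ∪ ((S ∪ T) ∩ ∁ T) ∩ ∁ S
                               ≤⟨ ∪-lub ∩-lowerʳ (⊆-trans rest⊆O O-⊆) ⟩
    S                          ∎
    where
    open ⊆-Reasoning
    rest⊆O : ((S ∪ T) ∩ ∁ T) ∩ ∁ S ⊆ O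
    rest⊆O = begin
      ((S ∪ T) ∩ ∁ T) ∩ ∁ S    ≤⟨ ∩-glb (⊆-trans ∩-lowerˡ ∩-lowerˡ)
                                        (∩-glb ∩-lowerʳ (⊆-trans ∩-lowerˡ ∩-lowerʳ)) ⟩
      (S ∪ T) ∩ (∁ S ∩ ∁ T)    ≡⟨ cong ((S ∪ T) ∩_) (∁-∪ S T) ⟨
      (S ∪ T) ∩ ∁ (S ∪ T)      ≤⟨ ∩-∁-⊆O (S ∪ T) ⟩
      O                        ∎

  ∪-resolveˡ : ∀ {R S T} → R ⊆ S ∪ T → R ⊆ ∁ S → R ⊆ T
  ∪-resolveˡ {S = S} {T} R⊆S∪T = ∪-resolveʳ (subst (_ ⊆_) (∪-comm S T) R⊆S∪T)

  -- Composition and converse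

  ⨾-monoˡ : ∀ {R S} T → R ⊆ S → R ⨾ T ⊆ S ⨾ T
  ⨾-monoˡ {R} {S} T R⊆S = trans (sym (⨾-distribʳ R S T)) (cong (_⨾ T) R⊆S)

  ᵀ-mono : ∀ {R S} → R ⊆ S → R ᵀ ⊆ S ᵀ
  ᵀ-mono {R} {S} R⊆S = trans (sym (ᵀ-distrib-∪ R S)) (cong _ᵀ R⊆S)

  ⊆ᵀ⇒ᵀ⊆ : ∀ {R S} → R ⊆ S ᵀ → R ᵀ ⊆ S
  ⊆ᵀ⇒ᵀ⊆ {R} {S} R⊆Sᵀ = subst (R ᵀ ⊆_) (ᵀ-involutive S) (ᵀ-mono R⊆Sᵀ)

  ᵀ⊆⇒⊆ᵀ : ∀ {R S} → R ᵀ ⊆ S → R ⊆ S ᵀ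
  ᵀ⊆⇒⊆ᵀ {R} {S} Rᵀ⊆S = subst (_⊆ S ᵀ) (ᵀ-involutive R) (ᵀ-mono Rᵀ⊆S)

  ⨾-distribˡ : ∀ R S T → R ⨾ (S ∪ T) ≡ R ⨾ S ∪ R ⨾ T
  ⨾-distribˡ R S T = begin
    R ⨾ (S ∪ T)                   ≡⟨ ᵀ-involutive _ ⟨
    ((R ⨾ (S ∪ T)) ᵀ) ᵀ           ≡⟨ cong _ᵀ (ᵀ-distrib-⨾ R (S ∪ T)) ⟩
    ((S ∪ T) ᵀ ⨾ R ᵀ) ᵀ           ≡⟨ cong (λ X → (X ⨾ R ᵀ) ᵀ) (ᵀ-distrib-∪ S T) ⟩
    ((S ᵀ ∪ T ᵀ) ⨾ R ᵀ) ᵀ         ≡⟨ cong _ᵀ (⨾-distribʳ (S ᵀ) (T ᵀ) (R ᵀ)) ⟩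
    (S ᵀ ⨾ R ᵀ ∪ T ᵀ ⨾ R ᵀ) ᵀ     ≡⟨ ᵀ-distrib-∪ _ _ ⟩
    (S ᵀ ⨾ R ᵀ) ᵀ ∪ (T ᵀ ⨾ R ᵀ) ᵀ ≡⟨ cong₂ (λ X Y → X ᵀ ∪ Y ᵀ) (ᵀ-distrib-⨾ R S)
                                                                (ᵀ-distrib-⨾ R T) ⟨
    ((R ⨾ S) ᵀ) ᵀ ∪ ((R ⨾ T) ᵀ) ᵀ ≡⟨ cong₂ _∪_ (ᵀ-involutive _) (ᵀ-involutive _) ⟩
    R ⨾ S ∪ R ⨾ T                 ∎
    where open ≡-Reasoning

  ⨾-monoʳ : ∀ R {S T} → S ⊆ T → R ⨾ S ⊆ R ⨾ T
  ⨾-monoʳ R {S} {T} S⊆T = trans (sym (⨾-distribˡ R S T)) (cong (R ⨾_) S⊆T)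

  ⨾-mono : ∀ {R R′ S S′} → R ⊆ R′ → S ⊆ S′ → R ⨾ S ⊆ R′ ⨾ S′
  ⨾-mono {R′ = R′} {S} R⊆R′ S⊆S′ = ⊆-trans (⨾-monoˡ S R⊆R′) (⨾-monoʳ R′ S⊆S′)

  ᵀ-L : L ᵀ ≡ L
  ᵀ-L = ⊆-antisym ⊆-L (subst (_⊆ L ᵀ) (ᵀ-involutive L) (ᵀ-mono ⊆-L))

  ⨾ᵀ-ᵀ : ∀ R S → (R ⨾ S ᵀ) ᵀ ≡ S ⨾ R ᵀ
  ⨾ᵀ-ᵀ R S = trans (ᵀ-distrib-⨾ R (S ᵀ)) (cong (_⨾ R ᵀ) (ᵀ-involutive S))

  ᵀ⨾-ᵀ : ∀ R S → (R ᵀ ⨾ S) ᵀ ≡ S ᵀ ⨾ R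
  ᵀ⨾-ᵀ R S = trans (ᵀ-distrib-⨾ (R ᵀ) S) (cong (S ᵀ ⨾_) (ᵀ-involutive R))

  L⨾-ᵀ : ∀ R → (L ⨾ R) ᵀ ≡ R ᵀ ⨾ L
  L⨾-ᵀ R = trans (ᵀ-distrib-⨾ L R) (cong (R ᵀ ⨾_) ᵀ-L)

  ᵀ⨾L-ᵀ : ∀ R → (R ᵀ ⨾ L) ᵀ ≡ L ⨾ R
  ᵀ⨾L-ᵀ R = trans (ᵀ⨾-ᵀ R L) (cong (_⨾ R) ᵀ-L)

  schröderᵀ : ∀ R S → R ⨾ ∁ (R ᵀ ⨾ S) ⊆ ∁ S
  schröderᵀ R S =
    subst (λ X → X ⨾ ∁ (R ᵀ ⨾ S) ⊆ ∁ S) (ᵀ-involutive R) (schröder (R ᵀ) S)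

  ⨾-zeroʳ : ∀ R → R ⨾ O ≡ O
  ⨾-zeroʳ R = ⊆O⇒≡O (begin
    R ⨾ O                ≤⟨ ⨾-monoʳ R O-⊆ ⟩
    R ⨾ ∁ (R ᵀ ⨾ L)      ≤⟨ schröderᵀ R L ⟩
    ∁ L                  ≡⟨ ∁-L ⟩
    O                    ∎)
    where open ⊆-Reasoning

  ᵀ-O : O ᵀ ≡ O
  ᵀ-O = begin
    O ᵀ                  ≡⟨ cong _ᵀ (⨾-zeroʳ (O ᵀ)) ⟨
    (O ᵀ ⨾ O) ᵀ          ≡⟨ ᵀ-distrib-⨾ (O ᵀ) O ⟩
    O ᵀ ⨾ (O ᵀ) ᵀ        ≡⟨ cong (O ᵀ ⨾_) (ᵀ-involutive O) ⟩
    O ᵀ ⨾ O              ≡⟨ ⨾-zeroʳ (O ᵀ) ⟩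
    O                    ∎
    where open ≡-Reasoning

  ⨾-zeroˡ : ∀ R → O ⨾ R ≡ O
  ⨾-zeroˡ R = begin
    O ⨾ R                ≡⟨ ᵀ-involutive _ ⟨
    ((O ⨾ R) ᵀ) ᵀ        ≡⟨ cong _ᵀ (ᵀ-distrib-⨾ O R) ⟩
    (R ᵀ ⨾ O ᵀ) ᵀ        ≡⟨ cong (λ X → (R ᵀ ⨾ X) ᵀ) ᵀ-O ⟩
    (R ᵀ ⨾ O) ᵀ          ≡⟨ cong _ᵀ (⨾-zeroʳ (R ᵀ)) ⟩
    O ᵀ                  ≡⟨ ᵀ-O ⟩
    O                    ∎
    where open ≡-Reasoning

  ⨾[⨾ᵀ]ᵀ≡O : ∀ {R v} w → R ⨾ v ≡ O → R ⨾ (w ⨾ v ᵀ) ᵀ ≡ O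
  ⨾[⨾ᵀ]ᵀ≡O {R} {v} w R⨾v≡O = begin
    R ⨾ (w ⨾ v ᵀ) ᵀ      ≡⟨ cong (R ⨾_) (⨾ᵀ-ᵀ w v) ⟩
    R ⨾ v ⨾ w ᵀ          ≡⟨ ⨾-assoc R v (w ᵀ) ⟨
    (R ⨾ v) ⨾ w ᵀ        ≡⟨ cong (_⨾ w ᵀ) R⨾v≡O ⟩
    O ⨾ w ᵀ              ≡⟨ ⨾-zeroˡ (w ᵀ) ⟩
    O                    ∎
    where open ≡-Reasoning

  ᵀ-∩ : ∀ R S → R ᵀ ∩ S ᵀ ⊆ (R ∩ S) ᵀ
  ᵀ-∩ R S = subst (_⊆ (R ∩ S) ᵀ) (ᵀ-involutive (R ᵀ ∩ S ᵀ))
              (ᵀ-mono (∩-glb (⊆ᵀ⇒ᵀ⊆ ∩-lowerˡ) (⊆ᵀ⇒ᵀ⊆ ∩-lowerʳ)))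

  ᵀ-∁ : ∀ R → ∁ R ᵀ ≡ ∁ (R ᵀ)
  ᵀ-∁ R = ⊆-antisym (disjoint⇒⊆∁ ∁Rᵀ∩Rᵀ⊆O) (∪-resolveʳ ∁[Rᵀ]⊆Rᵀ∪∁Rᵀ ⊆-refl)
    where
    open ⊆-Reasoning
    ∁Rᵀ∩Rᵀ⊆O : ∁ R ᵀ ∩ R ᵀ ⊆ O
    ∁Rᵀ∩Rᵀ⊆O = begin
      ∁ R ᵀ ∩ R ᵀ        ≤⟨ ᵀ-∩ (∁ R) R ⟩
      (∁ R ∩ R) ᵀ        ≡⟨ cong _ᵀ (∩-comm (∁ R) R) ⟩
      (R ∩ ∁ R) ᵀ        ≤⟨ ᵀ-mono (∩-∁-⊆O R) ⟩
      O ᵀ                ≡⟨ ᵀ-O ⟩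
      O                  ∎
    ∁[Rᵀ]⊆Rᵀ∪∁Rᵀ : ∁ (R ᵀ) ⊆ ∁ R ᵀ ∪ R ᵀ
    ∁[Rᵀ]⊆Rᵀ∪∁Rᵀ = begin
      ∁ (R ᵀ)            ≤⟨ ⊆-L ⟩
      L                  ≡⟨ ᵀ-L ⟨
      L ᵀ                ≤⟨ ᵀ-mono ⊆∪∁ ⟩
      (∁ R ∪ ∁ (∁ R)) ᵀ  ≡⟨ cong (λ X → (∁ R ∪ X) ᵀ) (∁-involutive R) ⟩
      (∁ R ∪ R) ᵀ        ≡⟨ ᵀ-distrib-∪ (∁ R) R ⟩
      ∁ R ᵀ ∪ R ᵀ        ∎

  dedekind : ∀ Q R S → Q ⨾ R ∩ S ⊆ Q ⨾ (R ∩ Q ᵀ ⨾ S)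
  dedekind Q R S =
    ∪-resolveʳ (⊆-trans ∩-lowerˡ Q⨾R⊆) (⊆-trans ∩-lowerʳ (⊆-reflexive (sym (∁-involutive S))))
    where
    open ⊆-Reasoning
    Q⨾R⊆ : Q ⨾ R ⊆ Q ⨾ (R ∩ Q ᵀ ⨾ S) ∪ ∁ S
    Q⨾R⊆ = begin
      Q ⨾ R                                      ≡⟨ cong (Q ⨾_) (∩-partition R (Q ᵀ ⨾ S)) ⟩
      Q ⨾ (R ∩ Q ᵀ ⨾ S ∪ R ∩ ∁ (Q ᵀ ⨾ S))        ≡⟨ ⨾-distribˡ Q _ _ ⟩
      Q ⨾ (R ∩ Q ᵀ ⨾ S) ∪ Q ⨾ (R ∩ ∁ (Q ᵀ ⨾ S))  ≤⟨ ∪-mono ⊆-refl (⨾-monoʳ Q ∩-lowerʳ) ⟩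
      Q ⨾ (R ∩ Q ᵀ ⨾ S) ∪ Q ⨾ ∁ (Q ᵀ ⨾ S)        ≤⟨ ∪-mono ⊆-refl (schröderᵀ Q S) ⟩
      Q ⨾ (R ∩ Q ᵀ ⨾ S) ∪ ∁ S                    ∎

  ⊆I⇒⊆ᵀ : ∀ {R} → R ⊆ I → R ⊆ R ᵀ
  ⊆I⇒⊆ᵀ {R} R⊆I = begin
    R                    ≤⟨ ∩-glb (⊆-reflexive (sym (⨾-identityʳ R))) R⊆I ⟩
    R ⨾ I ∩ I            ≤⟨ dedekind R I I ⟩
    R ⨾ (I ∩ R ᵀ ⨾ I)    ≤⟨ ⨾-monoʳ R ∩-lowerʳ ⟩
    R ⨾ (R ᵀ ⨾ I)        ≡⟨ cong (R ⨾_) (⨾-identityʳ (R ᵀ)) ⟩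
    R ⨾ R ᵀ              ≤⟨ ⨾-monoˡ (R ᵀ) R⊆I ⟩
    I ⨾ R ᵀ              ≡⟨ ⨾-identityˡ (R ᵀ) ⟩
    R ᵀ                  ∎
    where open ⊆-Reasoning

  -- Kleene star

  I⊆* : ∀ R → I ⊆ R *
  I⊆* R = ⊆-trans ∪-upperˡ (star-unfoldˡ R)

  ⨾*⊆* : ∀ R → R ⨾ R * ⊆ R *
  ⨾*⊆* R = ⊆-trans ∪-upperʳ (star-unfoldˡ R)

  *⨾⊆* : ∀ R → R * ⨾ R ⊆ R *
  *⨾⊆* R = ⊆-trans ∪-upperʳ (star-unfoldʳ R)

  ⊆* : ∀ R → R ⊆ R *
  ⊆* R = begin
    R          ≡⟨ ⨾-identityʳ R ⟨
    R ⨾ I      ≤⟨ ⨾-monoʳ R (I⊆* R) ⟩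
    R ⨾ R *    ≤⟨ ⨾*⊆* R ⟩
    R *        ∎
    where open ⊆-Reasoning

  *⨾*⊆* : ∀ R → R * ⨾ R * ⊆ R *
  *⨾*⊆* R = star-inductˡ R (R *) (R *) (∪-lub ⊆-refl (⨾*⊆* R))

  *-unfoldˡ : ∀ R → R * ⊆ I ∪ R ⨾ R *
  *-unfoldˡ R = subst (_⊆ I ∪ R ⨾ R *) (⨾-identityʳ (R *))
    (star-inductˡ R I (I ∪ R ⨾ R *) (∪-lub ∪-upperˡ (⊆-trans step ∪-upperʳ)))
    where
    step : R ⨾ (I ∪ R ⨾ R *) ⊆ R ⨾ R *
    step = ⨾-monoʳ R (∪-lub (I⊆* R) (⨾*⊆* R))

  *-unfoldʳ : ∀ R → R * ⊆ I ∪ R * ⨾ R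
  *-unfoldʳ R = subst (_⊆ I ∪ R * ⨾ R) (⨾-identityˡ (R *))
    (star-inductʳ R I (I ∪ R * ⨾ R) (∪-lub ∪-upperˡ (⊆-trans step ∪-upperʳ)))
    where
    step : (I ∪ R * ⨾ R) ⨾ R ⊆ R * ⨾ R
    step = ⨾-monoˡ R (∪-lub (I⊆* R) (*⨾⊆* R))

  *-least : ∀ {R S} → R ⊆ S * → R * ⊆ S *
  *-least {R} {S} R⊆S* = subst (_⊆ S *) (⨾-identityʳ (R *))
    (star-inductˡ R I (S *) (∪-lub (I⊆* S) (⊆-trans (⨾-monoˡ (S *) R⊆S*) (*⨾*⊆* S))))

  *-mono : ∀ {R S} → R ⊆ S → R * ⊆ S *
  *-mono {S = S} R⊆S = *-least (⊆-trans R⊆S (⊆* S))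

  ᵀ-*⊆ : ∀ R → (R *) ᵀ ⊆ R ᵀ*
  ᵀ-*⊆ R = ⊆ᵀ⇒ᵀ⊆ (subst (_⊆ (R ᵀ*) ᵀ) (⨾-identityʳ (R *))
    (star-inductˡ R I ((R ᵀ*) ᵀ) (∪-lub I⊆ R⨾⊆)))
    where
    I⊆ : I ⊆ (R ᵀ*) ᵀ
    I⊆ = subst (_⊆ (R ᵀ*) ᵀ) ᵀ-identity (ᵀ-mono (I⊆* (R ᵀ)))
    R⨾⊆ : R ⨾ (R ᵀ*) ᵀ ⊆ (R ᵀ*) ᵀ
    R⨾⊆ = subst (_⊆ (R ᵀ*) ᵀ)
            (trans (ᵀ-distrib-⨾ (R ᵀ*) (R ᵀ)) (cong (_⨾ (R ᵀ*) ᵀ) (ᵀ-involutive R)))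
            (ᵀ-mono (*⨾⊆* (R ᵀ)))

  ᵀ-* : ∀ R → (R *) ᵀ ≡ R ᵀ*
  ᵀ-* R = ⊆-antisym (ᵀ-*⊆ R)
    (ᵀ⊆⇒⊆ᵀ (subst (λ X → (R ᵀ*) ᵀ ⊆ X *) (ᵀ-involutive R) (ᵀ-*⊆ (R ᵀ))))

  ⊆ᵀ*⇒*≡ᵀ* : ∀ {R} → R ⊆ R ᵀ* → R * ≡ R ᵀ*
  ⊆ᵀ*⇒*≡ᵀ* {R} R⊆Rᵀ* = ⊆-antisym (*-least R⊆Rᵀ*) (*-least Rᵀ⊆R*)
    where
    Rᵀ⊆R* : R ᵀ ⊆ R *
    Rᵀ⊆R* = subst (R ᵀ ⊆_) (trans (ᵀ-* (R ᵀ)) (cong _* (ᵀ-involutive R)))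
                  (ᵀ-mono R⊆Rᵀ*)

  -- Vectors

  IsVector : B → Set c
  IsVector v = v ⨾ L ≡ v

  L⨾L : L ⨾ L ≡ L
  L⨾L = ⊆-antisym ⊆-L (subst (_⊆ L ⨾ L) (⨾-identityʳ L) (⨾-monoʳ L ⊆-L))

  ⊆⨾L : ∀ R → R ⊆ R ⨾ L
  ⊆⨾L R = subst (_⊆ R ⨾ L) (⨾-identityʳ R) (⨾-monoʳ R ⊆-L)

  ⊆L⨾ : ∀ R → R ⊆ L ⨾ R
  ⊆L⨾ R = subst (_⊆ L ⨾ R) (⨾-identityˡ R) (⨾-monoˡ R ⊆-L)

  ⨾L-isVector : ∀ R → IsVector (R ⨾ L)
  ⨾L-isVector R = trans (⨾-assoc R L L) (cong (R ⨾_) L⨾L)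

  ⨾-isVector : ∀ R {v} → IsVector v → IsVector (R ⨾ v)
  ⨾-isVector R {v} v⨾L≡v = trans (⨾-assoc R v L) (cong (R ⨾_) v⨾L≡v)

  ∩-isVector : ∀ {v w} → IsVector v → IsVector w → IsVector (v ∩ w)
  ∩-isVector {v} {w} v⨾L≡v w⨾L≡w = ⊆-antisym
    (∩-glb (⊆-trans (⨾-monoˡ L ∩-lowerˡ) (⊆-reflexive v⨾L≡v))
           (⊆-trans (⨾-monoˡ L ∩-lowerʳ) (⊆-reflexive w⨾L≡w)))
    (⊆⨾L (v ∩ w))

  L⨾ᵀ : ∀ {v} → IsVector v → L ⨾ v ᵀ ≡ v ᵀ
  L⨾ᵀ {v} v⨾L≡v = begin
    L ⨾ v ᵀ        ≡⟨ cong (_⨾ v ᵀ) ᵀ-L ⟨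
    L ᵀ ⨾ v ᵀ      ≡⟨ ᵀ-distrib-⨾ v L ⟨
    (v ⨾ L) ᵀ      ≡⟨ cong _ᵀ v⨾L≡v ⟩
    v ᵀ            ∎
    where open ≡-Reasoning

  ∁-isVector : ∀ {v} → IsVector v → IsVector (∁ v)
  ∁-isVector {v} v⨾L≡v = ⊆-antisym (ᵀ-reflect (begin
    (∁ v ⨾ L) ᵀ          ≡⟨ ᵀ-distrib-⨾ (∁ v) L ⟩
    L ᵀ ⨾ ∁ v ᵀ          ≡⟨ cong (L ᵀ ⨾_) (ᵀ-∁ v) ⟩
    L ᵀ ⨾ ∁ (v ᵀ)        ≡⟨ cong (λ X → L ᵀ ⨾ ∁ X) (L⨾ᵀ v⨾L≡v) ⟨
    L ᵀ ⨾ ∁ (L ⨾ v ᵀ)    ≤⟨ schröder L (v ᵀ) ⟩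
    ∁ (v ᵀ)              ≡⟨ ᵀ-∁ v ⟨
    ∁ v ᵀ                ∎)) (⊆⨾L (∁ v))
    where
    open ⊆-Reasoning
    ᵀ-reflect : ∀ {R S} → R ᵀ ⊆ S ᵀ → R ⊆ S
    ᵀ-reflect {R} {S} = subst (R ⊆_) (ᵀ-involutive S) ∘ ᵀ⊆⇒⊆ᵀ

  L⨾≡L : ∀ {v} → IsVector v → ¬ v ≡ O → L ⨾ v ≡ L
  L⨾≡L {v} v⨾L≡v v≢O = trans (cong (L ⨾_) (sym v⨾L≡v)) (proj₁ (tarski v) v≢O)

  ∩ᵀ⊆⨾ᵀ : ∀ {v w} → IsVector v → IsVector w → v ∩ w ᵀ ⊆ v ⨾ w ᵀ
  ∩ᵀ⊆⨾ᵀ {v} {w} v⨾L≡v w⨾L≡w = begin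
    v ∩ w ᵀ                ≡⟨ cong (_∩ w ᵀ) v⨾L≡v ⟨
    v ⨾ L ∩ w ᵀ            ≤⟨ dedekind v L (w ᵀ) ⟩
    v ⨾ (L ∩ v ᵀ ⨾ w ᵀ)    ≤⟨ ⨾-monoʳ v (⊆-trans ∩-lowerʳ (⨾-monoˡ (w ᵀ) ⊆-L)) ⟩
    v ⨾ (L ⨾ w ᵀ)          ≡⟨ cong (v ⨾_) (L⨾ᵀ w⨾L≡w) ⟩
    v ⨾ w ᵀ                ∎
    where open ⊆-Reasoning

  ⊆⨾L⇒⊆⨾ᵀ⨾ : ∀ {R S} → S ⊆ R ⨾ L → S ⊆ R ⨾ R ᵀ ⨾ S
  ⊆⨾L⇒⊆⨾ᵀ⨾ {R} {S} S⊆R⨾L = begin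
    S                      ≤⟨ ∩-glb S⊆R⨾L ⊆-refl ⟩
    R ⨾ L ∩ S              ≤⟨ dedekind R L S ⟩
    R ⨾ (L ∩ R ᵀ ⨾ S)      ≤⟨ ⨾-monoʳ R ∩-lowerʳ ⟩
    R ⨾ R ᵀ ⨾ S            ∎
    where open ⊆-Reasoning

  ⊆⨾L∩L⨾ : ∀ R → R ⊆ R ⨾ L ∩ L ⨾ R
  ⊆⨾L∩L⨾ R = ∩-glb (⊆⨾L R) (⊆L⨾ R)

  ⨾L⨾⊆⨾L∩L⨾ : ∀ R → R ⨾ L ⨾ R ⊆ R ⨾ L ∩ L ⨾ R
  ⨾L⨾⊆⨾L∩L⨾ R = ∩-glb
    (⊆-trans (⨾-monoʳ R (⨾-monoʳ L ⊆-L)) (⊆-reflexive (cong (R ⨾_) L⨾L)))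
    (⊆-trans (⊆-reflexive (sym (⨾-assoc R L R))) (⨾-monoˡ R ⊆-L))

  ⨾L∩L⨾⊆⨾ᵀ : ∀ {R v w} → IsVector v → IsVector w →
             R ⨾ L ⊆ v → R ᵀ ⨾ L ⊆ w → R ⨾ L ∩ L ⨾ R ⊆ v ⨾ w ᵀ
  ⨾L∩L⨾⊆⨾ᵀ {R} {w = w} v-vec w-vec R⨾L⊆v Rᵀ⨾L⊆w =
    ⊆-trans (∩-mono R⨾L⊆v L⨾R⊆wᵀ) (∩ᵀ⊆⨾ᵀ v-vec w-vec)
    where
    L⨾R⊆wᵀ : L ⨾ R ⊆ w ᵀ
    L⨾R⊆wᵀ = subst (_⊆ w ᵀ) (ᵀ⨾L-ᵀ R) (ᵀ-mono Rᵀ⨾L⊆w)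

  ∪⨾⨾L⊆ : ∀ R {v} S → IsVector v → (R ∪ v ⨾ S) ⨾ L ⊆ R ⨾ L ∪ v
  ∪⨾⨾L⊆ R {v} S v⨾L≡v = begin
    (R ∪ v ⨾ S) ⨾ L        ≡⟨ ⨾-distribʳ R (v ⨾ S) L ⟩
    R ⨾ L ∪ (v ⨾ S) ⨾ L    ≡⟨ cong (R ⨾ L ∪_) (⨾-assoc v S L) ⟩
    R ⨾ L ∪ v ⨾ S ⨾ L      ≤⟨ ∪-mono ⊆-refl (⨾-monoʳ v ⊆-L) ⟩
    R ⨾ L ∪ v ⨾ L          ≡⟨ cong (R ⨾ L ∪_) v⨾L≡v ⟩
    R ⨾ L ∪ v              ∎
    where open ⊆-Reasoning

  -- Injective, univalent and connected relations

  univalent⇒ᵀ-injective : ∀ {R} → Univalent R → Injective (R ᵀ)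
  univalent⇒ᵀ-injective {R} = subst (λ X → R ᵀ ⨾ X ⊆ I) (sym (ᵀ-involutive R))

  injective⇒ᵀ-univalent : ∀ {R} → Injective R → Univalent (R ᵀ)
  injective⇒ᵀ-univalent {R} = subst (λ X → X ⨾ R ᵀ ⊆ I) (sym (ᵀ-involutive R))

  ᵀ-injective⇒univalent : ∀ {R} → Injective (R ᵀ) → Univalent R
  ᵀ-injective⇒univalent {R} = subst (λ X → R ᵀ ⨾ X ⊆ I) (ᵀ-involutive R)

  ∪-injective : ∀ {R S} → Injective R → Injective S → R ⨾ S ᵀ ≡ O → Injective (R ∪ S)
  ∪-injective {R} {S} R-inj S-inj R⨾Sᵀ≡O = begin
    (R ∪ S) ⨾ (R ∪ S) ᵀ                        ≡⟨ cong ((R ∪ S) ⨾_) (ᵀ-distrib-∪ R S) ⟩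
    (R ∪ S) ⨾ (R ᵀ ∪ S ᵀ)                      ≡⟨ ⨾-distribʳ R S _ ⟩
    R ⨾ (R ᵀ ∪ S ᵀ) ∪ S ⨾ (R ᵀ ∪ S ᵀ)          ≡⟨ cong₂ _∪_ (⨾-distribˡ R _ _) (⨾-distribˡ S _ _) ⟩
    (R ⨾ R ᵀ ∪ R ⨾ S ᵀ) ∪ (S ⨾ R ᵀ ∪ S ⨾ S ᵀ)  ≤⟨ ∪-lub (∪-lub R-inj (≡O⇒⊆ R⨾Sᵀ≡O))
                                                         (∪-lub (≡O⇒⊆ S⨾Rᵀ≡O) S-inj) ⟩
    I                                          ∎
    where
    open ⊆-Reasoning
    ≡O⇒⊆ : ∀ {X} → X ≡ O → X ⊆ I
    ≡O⇒⊆ X≡O = ⊆-trans (⊆-reflexive X≡O) O-⊆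
    S⨾Rᵀ≡O : S ⨾ R ᵀ ≡ O
    S⨾Rᵀ≡O = trans (sym (⨾ᵀ-ᵀ R S)) (trans (cong _ᵀ R⨾Sᵀ≡O) ᵀ-O)

  ⨾ᵀ-injective : ∀ {v} w → IsVector v → Injective v → Injective (v ⨾ w ᵀ)
  ⨾ᵀ-injective {v} w v⨾L≡v v-inj = begin
    (v ⨾ w ᵀ) ⨾ (v ⨾ w ᵀ) ᵀ          ≡⟨ cong ((v ⨾ w ᵀ) ⨾_) (⨾ᵀ-ᵀ v w) ⟩
    (v ⨾ w ᵀ) ⨾ (w ⨾ v ᵀ)            ≡⟨ ⨾-assoc v (w ᵀ) (w ⨾ v ᵀ) ⟩
    v ⨾ w ᵀ ⨾ w ⨾ v ᵀ                ≡⟨ cong (v ⨾_) (⨾-assoc (w ᵀ) w (v ᵀ)) ⟨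
    v ⨾ (w ᵀ ⨾ w) ⨾ v ᵀ              ≤⟨ ⨾-monoʳ v (⨾-monoˡ (v ᵀ) ⊆-L) ⟩
    v ⨾ L ⨾ v ᵀ                      ≡⟨ cong (v ⨾_) (L⨾ᵀ v⨾L≡v) ⟩
    v ⨾ v ᵀ                          ≤⟨ v-inj ⟩
    I                                ∎
    where open ⊆-Reasoning

  connected-ᵀ : ∀ {R} → Connected R → Connected (R ᵀ)
  connected-ᵀ {R} R-conn = begin
    R ᵀ ⨾ L ⨾ R ᵀ              ≡⟨ cong (λ X → R ᵀ ⨾ X ⨾ R ᵀ) ᵀ-L ⟨
    R ᵀ ⨾ L ᵀ ⨾ R ᵀ            ≡⟨ ⨾-assoc (R ᵀ) (L ᵀ) (R ᵀ) ⟨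
    (R ᵀ ⨾ L ᵀ) ⨾ R ᵀ          ≡⟨ cong (_⨾ R ᵀ) (ᵀ-distrib-⨾ L R) ⟨
    (L ⨾ R) ᵀ ⨾ R ᵀ            ≡⟨ ᵀ-distrib-⨾ R (L ⨾ R) ⟨
    (R ⨾ L ⨾ R) ᵀ              ≤⟨ ᵀ-mono R-conn ⟩
    (R * ∪ R ᵀ*) ᵀ             ≡⟨ ᵀ-distrib-∪ (R *) (R ᵀ*) ⟩
    (R *) ᵀ ∪ (R ᵀ*) ᵀ         ≡⟨ cong₂ _∪_ (ᵀ-* R) (ᵀ-* (R ᵀ)) ⟩
    R ᵀ* ∪ (R ᵀ) ᵀ*            ∎
    where open ⊆-Reasoning

  path-ᵀ : ∀ {R} → IsPath R → IsPath (R ᵀ)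
  path-ᵀ (R-inj , R-univ , R-conn) =
    univalent⇒ᵀ-injective R-univ , injective⇒ᵀ-univalent R-inj , connected-ᵀ R-conn

  -- Start and end points of a path

  sp-isVector : ∀ P → IsVector (sp P)
  sp-isVector P = ∩-isVector (⨾L-isVector P) (∁-isVector (⨾L-isVector (P ᵀ)))

  ep-isVector : ∀ P → IsVector (ep P)
  ep-isVector P = ∩-isVector (⨾L-isVector (P ᵀ)) (∁-isVector (⨾L-isVector P))

  sp-ᵀ : ∀ P → sp (P ᵀ) ≡ ep P
  sp-ᵀ P = cong (λ X → P ᵀ ⨾ L ∩ ∁ (X ⨾ L)) (ᵀ-involutive P)

  ⨾sp≡O : ∀ P → P ⨾ sp P ≡ O
  ⨾sp≡O P = ⊆O⇒≡O (begin
    P ⨾ sp P            ≤⟨ ⨾-monoʳ P ∩-lowerʳ ⟩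
    P ⨾ ∁ (P ᵀ ⨾ L)     ≤⟨ schröderᵀ P L ⟩
    ∁ L                 ≡⟨ ∁-L ⟩
    O                   ∎)
    where open ⊆-Reasoning

  ᵀ⨾ep≡O : ∀ P → P ᵀ ⨾ ep P ≡ O
  ᵀ⨾ep≡O P = ⊆O⇒≡O (begin
    P ᵀ ⨾ ep P          ≤⟨ ⨾-monoʳ (P ᵀ) ∩-lowerʳ ⟩
    P ᵀ ⨾ ∁ (P ⨾ L)     ≤⟨ schröder P L ⟩
    ∁ L                 ≡⟨ ∁-L ⟩
    O                   ∎)
    where open ⊆-Reasoning

  spᵀ⊆∁L⨾ : ∀ P → sp P ᵀ ⊆ ∁ (L ⨾ P)
  spᵀ⊆∁L⨾ P = begin
    sp P ᵀ              ≤⟨ ᵀ-mono ∩-lowerʳ ⟩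
    ∁ (P ᵀ ⨾ L) ᵀ       ≡⟨ ᵀ-∁ (P ᵀ ⨾ L) ⟩
    ∁ ((P ᵀ ⨾ L) ᵀ)     ≡⟨ cong ∁ (ᵀ⨾L-ᵀ P) ⟩
    ∁ (L ⨾ P)           ∎
    where open ⊆-Reasoning

  sp∩L⨾⊆∁I : ∀ P → sp P ∩ L ⨾ P ⊆ ∁ I
  sp∩L⨾⊆∁I P = disjoint⇒⊆∁ (begin
    (sp P ∩ L ⨾ P) ∩ I         ≤⟨ ∩-glb (⊆-trans ∩-lowerˡ (⊆-trans ∩-lowerˡ ∩-lowerʳ))
                                         ⊆ᵀ⨾L ⟩
    ∁ (P ᵀ ⨾ L) ∩ P ᵀ ⨾ L      ≡⟨ ∩-comm _ _ ⟩
    P ᵀ ⨾ L ∩ ∁ (P ᵀ ⨾ L)      ≤⟨ ∩-∁-⊆O _ ⟩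
    O                          ∎)
    where
    open ⊆-Reasoning
    ⊆ᵀ⨾L : (sp P ∩ L ⨾ P) ∩ I ⊆ P ᵀ ⨾ L
    ⊆ᵀ⨾L = begin
      (sp P ∩ L ⨾ P) ∩ I         ≤⟨ ⊆I⇒⊆ᵀ ∩-lowerʳ ⟩
      ((sp P ∩ L ⨾ P) ∩ I) ᵀ     ≤⟨ ᵀ-mono (⊆-trans ∩-lowerˡ ∩-lowerʳ) ⟩
      (L ⨾ P) ᵀ                  ≡⟨ L⨾-ᵀ P ⟩
      P ᵀ ⨾ L                    ∎

  sp⨾L⨾⊆*⨾ : ∀ {P} → Connected P → sp P ⨾ L ⨾ P ⊆ P * ⨾ P
  sp⨾L⨾⊆*⨾ {P} P-conn = ∪-resolveˡ (⊆-trans Z⊆* (*-unfoldʳ P)) Z⊆∁I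
    where
    open ⊆-Reasoning
    Z = sp P ⨾ L ⨾ P
    Z⊆sp : Z ⊆ sp P
    Z⊆sp = ⊆-trans (⨾-monoʳ (sp P) ⊆-L) (⊆-reflexive (sp-isVector P))
    Z⊆L⨾ : Z ⊆ L ⨾ P
    Z⊆L⨾ = ⊆-trans (⊆-reflexive (sym (⨾-assoc (sp P) L P))) (⨾-monoˡ P ⊆-L)
    Z⊆∁I : Z ⊆ ∁ I
    Z⊆∁I = ⊆-trans (∩-glb Z⊆sp Z⊆L⨾) (sp∩L⨾⊆∁I P)
    Z⊆∁ᵀ⨾ : Z ⊆ ∁ (P ᵀ ⨾ P ᵀ*)
    Z⊆∁ᵀ⨾ = ⊆-trans Z⊆sp (⊆-trans ∩-lowerʳ (∁-antitone (⨾-monoʳ (P ᵀ) ⊆-L)))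
    Z⊆∁ᵀ* : Z ⊆ ∁ (P ᵀ*)
    Z⊆∁ᵀ* = begin
      Z                          ≤⟨ ∩-glb Z⊆∁I Z⊆∁ᵀ⨾ ⟩
      ∁ I ∩ ∁ (P ᵀ ⨾ P ᵀ*)       ≡⟨ ∁-∪ I (P ᵀ ⨾ P ᵀ*) ⟨
      ∁ (I ∪ P ᵀ ⨾ P ᵀ*)         ≤⟨ ∁-antitone (*-unfoldˡ (P ᵀ)) ⟩
      ∁ (P ᵀ*)                   ∎
    Z⊆* : Z ⊆ P *
    Z⊆* = ∪-resolveʳ (begin
      sp P ⨾ L ⨾ P               ≤⟨ ⨾-monoˡ (L ⨾ P) ∩-lowerˡ ⟩
      (P ⨾ L) ⨾ L ⨾ P            ≡⟨ ⨾-assoc P L (L ⨾ P) ⟩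
      P ⨾ L ⨾ L ⨾ P              ≡⟨ cong (P ⨾_) (⨾-assoc L L P) ⟨
      P ⨾ (L ⨾ L) ⨾ P            ≡⟨ cong (λ X → P ⨾ X ⨾ P) L⨾L ⟩
      P ⨾ L ⨾ P                  ≤⟨ P-conn ⟩
      P * ∪ P ᵀ*                 ∎) Z⊆∁ᵀ*

  sp-injective : ∀ {P} → IsPath P → Injective (sp P)
  sp-injective {P} (P-inj , _ , P-conn) =
    ∪-resolveʳ (⊆-trans s⨾sᵀ⊆* (*-unfoldʳ P)) s⨾sᵀ⊆∁
    where
    open ⊆-Reasoning
    s = sp P
    s⨾sᵀ⊆* : s ⨾ s ᵀ ⊆ P *
    s⨾sᵀ⊆* = begin
      s ⨾ s ᵀ                    ≤⟨ ⨾-monoʳ s (ᵀ-mono (⊆⨾L⇒⊆⨾ᵀ⨾ ∩-lowerˡ)) ⟩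
      s ⨾ (P ⨾ P ᵀ ⨾ s) ᵀ        ≡⟨ cong (s ⨾_) (ᵀ-distrib-⨾ P (P ᵀ ⨾ s)) ⟩
      s ⨾ (P ᵀ ⨾ s) ᵀ ⨾ P ᵀ      ≡⟨ cong (λ X → s ⨾ X ⨾ P ᵀ) (ᵀ⨾-ᵀ P s) ⟩
      s ⨾ (s ᵀ ⨾ P) ⨾ P ᵀ        ≤⟨ ⨾-monoʳ s (⨾-monoˡ (P ᵀ) (⨾-monoˡ P ⊆-L)) ⟩
      s ⨾ (L ⨾ P) ⨾ P ᵀ          ≡⟨ ⨾-assoc s (L ⨾ P) (P ᵀ) ⟨
      (s ⨾ L ⨾ P) ⨾ P ᵀ          ≤⟨ ⨾-monoˡ (P ᵀ) (sp⨾L⨾⊆*⨾ P-conn) ⟩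
      (P * ⨾ P) ⨾ P ᵀ            ≡⟨ ⨾-assoc (P *) P (P ᵀ) ⟩
      P * ⨾ P ⨾ P ᵀ              ≤⟨ ⨾-monoʳ (P *) P-inj ⟩
      P * ⨾ I                    ≡⟨ ⨾-identityʳ (P *) ⟩
      P *                        ∎
    s⨾sᵀ⊆∁ : s ⨾ s ᵀ ⊆ ∁ (P * ⨾ P)
    s⨾sᵀ⊆∁ = begin
      s ⨾ s ᵀ                    ≤⟨ ⨾-monoˡ (s ᵀ) ⊆-L ⟩
      L ⨾ s ᵀ                    ≡⟨ L⨾ᵀ (sp-isVector P) ⟩
      s ᵀ                        ≤⟨ spᵀ⊆∁L⨾ P ⟩
      ∁ (L ⨾ P)                  ≤⟨ ∁-antitone (⨾-monoˡ P ⊆-L) ⟩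
      ∁ (P * ⨾ P)                ∎

  ep-injective : ∀ {P} → IsPath P → Injective (ep P)
  ep-injective {P} P-path = subst Injective (sp-ᵀ P) (sp-injective (path-ᵀ P-path))

  ⨾ᵀ*⨾sp⊆ : ∀ {P} → Injective P → P ⨾ P ᵀ* ⨾ sp P ⊆ P ᵀ* ⨾ sp P
  ⨾ᵀ*⨾sp⊆ {P} P-inj = begin
    P ⨾ P ᵀ* ⨾ s                     ≤⟨ ⨾-monoʳ P (⨾-monoˡ s (*-unfoldˡ (P ᵀ))) ⟩
    P ⨾ (I ∪ P ᵀ ⨾ P ᵀ*) ⨾ s         ≡⟨ cong (P ⨾_) (⨾-distribʳ I (P ᵀ ⨾ P ᵀ*) s) ⟩
    P ⨾ (I ⨾ s ∪ (P ᵀ ⨾ P ᵀ*) ⨾ s)   ≡⟨ cong₂ (λ X Y → P ⨾ (X ∪ Y)) (⨾-identityˡ s)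
                                                                  (⨾-assoc (P ᵀ) (P ᵀ*) s) ⟩
    P ⨾ (s ∪ P ᵀ ⨾ P ᵀ* ⨾ s)         ≡⟨ ⨾-distribˡ P s _ ⟩
    P ⨾ s ∪ P ⨾ P ᵀ ⨾ P ᵀ* ⨾ s       ≡⟨ cong₂ _∪_ (⨾sp≡O P) (sym (⨾-assoc P (P ᵀ) _)) ⟩
    O ∪ (P ⨾ P ᵀ) ⨾ P ᵀ* ⨾ s         ≤⟨ ∪-mono ⊆-refl (⨾-monoˡ (P ᵀ* ⨾ s) P-inj) ⟩
    O ∪ I ⨾ P ᵀ* ⨾ s                 ≡⟨ cong (O ∪_) (⨾-identityˡ (P ᵀ* ⨾ s)) ⟩
    O ∪ P ᵀ* ⨾ s                     ≡⟨ O-⊆ ⟩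
    P ᵀ* ⨾ s                         ∎
    where
    open ⊆-Reasoning
    s = sp P

  ⨾L∪ᵀ⨾L⊆ᵀ*⨾sp : ∀ {P} → IsPath P → ¬ sp P ≡ O → P ⨾ L ∪ P ᵀ ⨾ L ⊆ P ᵀ* ⨾ sp P
  ⨾L∪ᵀ⨾L⊆ᵀ*⨾sp {P} (P-inj , _ , P-conn) s≢O = ∪-lub ⨾L⊆v ᵀ⨾L⊆v
    where
    open ⊆-Reasoning
    s = sp P
    v = P ᵀ* ⨾ s
    ᵀ⨾v⊆v : P ᵀ ⨾ v ⊆ v
    ᵀ⨾v⊆v = ⊆-trans (⊆-reflexive (sym (⨾-assoc (P ᵀ) (P ᵀ*) s))) (⨾-monoˡ s (⨾*⊆* (P ᵀ)))
    ᵀ*⨾v⊆v : P ᵀ* ⨾ v ⊆ v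
    ᵀ*⨾v⊆v = ⊆-trans (⊆-reflexive (sym (⨾-assoc (P ᵀ*) (P ᵀ*) s))) (⨾-monoˡ s (*⨾*⊆* (P ᵀ)))
    *⨾v⊆v : P * ⨾ v ⊆ v
    *⨾v⊆v = star-inductˡ P v v (∪-lub ⊆-refl (⨾ᵀ*⨾sp⊆ P-inj))
    ⨾L⊆v : P ⨾ L ⊆ v
    ⨾L⊆v = begin
      P ⨾ L                      ≡⟨ cong (P ⨾_) (L⨾≡L (sp-isVector P) s≢O) ⟨
      P ⨾ L ⨾ s                  ≤⟨ ⨾-monoʳ P (⨾-monoʳ L (⊆⨾L⇒⊆⨾ᵀ⨾ ∩-lowerˡ)) ⟩
      P ⨾ L ⨾ P ⨾ P ᵀ ⨾ s        ≡⟨ cong (P ⨾_) (⨾-assoc L P (P ᵀ ⨾ s)) ⟨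
      P ⨾ (L ⨾ P) ⨾ P ᵀ ⨾ s      ≡⟨ ⨾-assoc P (L ⨾ P) (P ᵀ ⨾ s) ⟨
      (P ⨾ L ⨾ P) ⨾ P ᵀ ⨾ s      ≤⟨ ⨾-mono P-conn (⨾-monoˡ s (⊆* (P ᵀ))) ⟩
      (P * ∪ P ᵀ*) ⨾ v           ≡⟨ ⨾-distribʳ (P *) (P ᵀ*) v ⟩
      P * ⨾ v ∪ P ᵀ* ⨾ v         ≤⟨ ∪-lub *⨾v⊆v ᵀ*⨾v⊆v ⟩
      v                          ∎
    ᵀ⨾L⊆v : P ᵀ ⨾ L ⊆ v
    ᵀ⨾L⊆v = begin
      P ᵀ ⨾ L                    ≤⟨ ⊆⨾L⇒⊆⨾ᵀ⨾ ⊆-refl ⟩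
      P ᵀ ⨾ (P ᵀ) ᵀ ⨾ P ᵀ ⨾ L    ≡⟨ cong (λ X → P ᵀ ⨾ X ⨾ P ᵀ ⨾ L) (ᵀ-involutive P) ⟩
      P ᵀ ⨾ P ⨾ P ᵀ ⨾ L          ≤⟨ ⨾-monoʳ (P ᵀ) (⨾-monoʳ P ⊆-L) ⟩
      P ᵀ ⨾ P ⨾ L                ≤⟨ ⨾-monoʳ (P ᵀ) ⨾L⊆v ⟩
      P ᵀ ⨾ v                    ≤⟨ ᵀ⨾v⊆v ⟩
      v                          ∎

  ᵀ⨾L∪⨾L⊆*⨾ep : ∀ {P} → IsPath P → ¬ ep P ≡ O → P ᵀ ⨾ L ∪ P ⨾ L ⊆ P * ⨾ ep P
  ᵀ⨾L∪⨾L⊆*⨾ep {P} P-path e≢O =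
    subst (λ X → P ᵀ ⨾ L ∪ X ⨾ L ⊆ X * ⨾ (P ᵀ ⨾ L ∩ ∁ (X ⨾ L))) (ᵀ-involutive P)
      (⨾L∪ᵀ⨾L⊆ᵀ*⨾sp (path-ᵀ P-path) (e≢O ∘ trans (sym (sp-ᵀ P))))

  -- Closing a path

  close : B → B
  close P = P ∪ ep P ⨾ sp P ᵀ

  close-ᵀ : ∀ P → close P ᵀ ≡ P ᵀ ∪ sp P ⨾ ep P ᵀ
  close-ᵀ P = trans (ᵀ-distrib-∪ P _) (cong (P ᵀ ∪_) (⨾ᵀ-ᵀ (ep P) (sp P)))

  close-injective : ∀ {P} → IsPath P → Injective (close P)
  close-injective {P} P-path@(P-inj , _ , _) =
    ∪-injective P-inj
      (⨾ᵀ-injective (sp P) (ep-isVector P) (ep-injective P-path))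
      (⨾[⨾ᵀ]ᵀ≡O (ep P) (⨾sp≡O P))

  close-univalent : ∀ {P} → IsPath P → Univalent (close P)
  close-univalent {P} P-path@(_ , P-univ , _) =
    ᵀ-injective⇒univalent (subst Injective (sym (close-ᵀ P))
      (∪-injective (univalent⇒ᵀ-injective P-univ)
        (⨾ᵀ-injective (ep P) (sp-isVector P) (sp-injective P-path))
        (⨾[⨾ᵀ]ᵀ≡O (sp P) (ᵀ⨾ep≡O P))))

  close⨾L⊆ : ∀ P → close P ⨾ L ⊆ P ⨾ L ∪ P ᵀ ⨾ L
  close⨾L⊆ P = ⊆-trans (∪⨾⨾L⊆ P (sp P ᵀ) (ep-isVector P)) (∪-mono ⊆-refl ∩-lowerˡ)

  closeᵀ⨾L⊆ : ∀ P → close P ᵀ ⨾ L ⊆ P ᵀ ⨾ L ∪ P ⨾ L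
  closeᵀ⨾L⊆ P = subst (λ X → X ⨾ L ⊆ P ᵀ ⨾ L ∪ P ⨾ L) (sym (close-ᵀ P))
    (⊆-trans (∪⨾⨾L⊆ (P ᵀ) (ep P ᵀ) (sp-isVector P)) (∪-mono ⊆-refl ∩-lowerˡ))

  close-wraps : ∀ {P} → IsPath P → ¬ sp P ≡ O → ¬ ep P ≡ O →
                close P ⨾ L ∩ L ⨾ close P ⊆ close P ᵀ*
  close-wraps {P} P-path s≢O e≢O = begin
    X ⨾ L ∩ L ⨾ X                  ≤⟨ ⨾L∩L⨾⊆⨾ᵀ (⨾-isVector (P ᵀ*) (sp-isVector P))
                                               (⨾-isVector (P *) (ep-isVector P))
                                               (⊆-trans (close⨾L⊆ P) (⨾L∪ᵀ⨾L⊆ᵀ*⨾sp P-path s≢O))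
                                               (⊆-trans (closeᵀ⨾L⊆ P) (ᵀ⨾L∪⨾L⊆*⨾ep P-path e≢O)) ⟩
    (P ᵀ* ⨾ s) ⨾ (P * ⨾ e) ᵀ       ≡⟨ cong ((P ᵀ* ⨾ s) ⨾_) (ᵀ-distrib-⨾ (P *) e) ⟩
    (P ᵀ* ⨾ s) ⨾ e ᵀ ⨾ (P *) ᵀ     ≡⟨ cong (λ Y → (P ᵀ* ⨾ s) ⨾ e ᵀ ⨾ Y) (ᵀ-* P) ⟩
    (P ᵀ* ⨾ s) ⨾ e ᵀ ⨾ P ᵀ*        ≡⟨ ⨾-assoc (P ᵀ*) s (e ᵀ ⨾ P ᵀ*) ⟩
    P ᵀ* ⨾ s ⨾ e ᵀ ⨾ P ᵀ*          ≡⟨ cong (P ᵀ* ⨾_) (⨾-assoc s (e ᵀ) (P ᵀ*)) ⟨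
    P ᵀ* ⨾ (s ⨾ e ᵀ) ⨾ P ᵀ*        ≤⟨ ⨾-mono (*-mono Pᵀ⊆Xᵀ) (⨾-mono s⨾eᵀ⊆Xᵀ (*-mono Pᵀ⊆Xᵀ)) ⟩
    X ᵀ* ⨾ X ᵀ ⨾ X ᵀ*              ≤⟨ ⨾-monoʳ (X ᵀ*) (⨾*⊆* (X ᵀ)) ⟩
    X ᵀ* ⨾ X ᵀ*                    ≤⟨ *⨾*⊆* (X ᵀ) ⟩
    X ᵀ*                           ∎
    where
    open ⊆-Reasoning
    X = close P
    s = sp P
    e = ep P
    Pᵀ⊆Xᵀ : P ᵀ ⊆ X ᵀ
    Pᵀ⊆Xᵀ = ᵀ-mono ∪-upperˡ
    s⨾eᵀ⊆Xᵀ : s ⨾ e ᵀ ⊆ X ᵀ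
    s⨾eᵀ⊆Xᵀ = subst (s ⨾ e ᵀ ⊆_) (sym (close-ᵀ P)) ∪-upperʳ

  close-isCycle : ∀ {P} → IsPath P → ¬ sp P ≡ O → ¬ ep P ≡ O → IsCycle (close P)
  close-isCycle {P} P-path s≢O e≢O =
    (close-injective P-path , close-univalent P-path , close-connected) ,
    ⊆ᵀ*⇒*≡ᵀ* (⊆-trans (⊆⨾L∩L⨾ (close P)) wraps)
    where
    wraps = close-wraps P-path s≢O e≢O
    close-connected : Connected (close P)
    close-connected = ⊆-trans (⨾L⨾⊆⨾L∩L⨾ (close P)) (⊆-trans wraps ∪-upperʳ)

  close-O : close O ≡ O
  close-O = begin
    O ∪ ep O ⨾ sp O ᵀ      ≡⟨ cong (λ X → O ∪ ep O ⨾ X ᵀ) sp-O ⟩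
    O ∪ ep O ⨾ O ᵀ         ≡⟨ cong (λ X → O ∪ ep O ⨾ X) ᵀ-O ⟩
    O ∪ ep O ⨾ O           ≡⟨ cong (O ∪_) (⨾-zeroʳ (ep O)) ⟩
    O ∪ O                  ≡⟨ ∪-idem O ⟩
    O                      ∎
    where
    open ≡-Reasoning
    sp-O : sp O ≡ O
    sp-O = ⊆O⇒≡O (⊆-trans ∩-lowerˡ (⊆-reflexive (⨾-zeroˡ L)))

  O-isCycle : IsCycle O
  O-isCycle = (O⨾⊆ (O ᵀ) , ⨾O⊆ (O ᵀ) , O⨾⊆ (L ⨾ O)) , cong _* (sym ᵀ-O)
    where
    O⨾⊆ : ∀ R {S} → O ⨾ R ⊆ S
    O⨾⊆ R = ⊆-trans (⊆-reflexive (⨾-zeroˡ R)) O-⊆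
    ⨾O⊆ : ∀ R {S} → R ⨾ O ⊆ S
    ⨾O⊆ R = ⊆-trans (⊆-reflexive (⨾-zeroʳ R)) O-⊆

  ≡O⇒close-isCycle : ∀ {R} → R ≡ O → IsCycle (close R)
  ≡O⇒close-isCycle refl = subst IsCycle (sym close-O) O-isCycle

mainTheorem11 : ∀ {c : Level} (K : KleeneRelationAlgebra c) →
    let open KleeneRelationAlgebra K in
      ∀ R → IsTerminating R → IsCycle (R ∪ ep R ⨾ sp R ᵀ)
mainTheorem11 K R (R-path , inj₁ s≢O , inj₁ e≢O) = close-isCycle R-path s≢O e≢O
  where open KleeneRelationAlgebraProperties K
mainTheorem11 K R (_ , inj₂ R≡O , _) = ≡O⇒close-isCycle R≡O
  where open KleeneRelationAlgebraProperties K
mainTheorem11 K R (_ , inj₁ _ , inj₂ R≡O) = ≡O⇒close-isCycle R≡O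
  where open KleeneRelationAlgebraProperties K
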